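{- Every IK-AoN instance has an optimal chain that is independent.
   Context: An IK-AoN instance consists of: items $[n]$, each with nonnegative weight $w_i$ and profit $p_i\in\{1,2,\dots\}$; times $t\in[T]$ with coefficients $\Delta_t\in\{0,1,2,\dots\}$ and capacities $W_t\in\{1,2,\dots\}$, $W_1\le\dots\le W_T$; and an aggregation function $\gamma:2^{[n]}\to\mathbb Z_+$ with $\gamma(\emptyset)=0$, monotonically non-decreasing, submodular, and with $\gamma(S\cup\{i\})-\gamma(S)\in\{0,p_i\}$ for all $i\in[n]$, $S\subseteq[n]$. A chain $(S_1,\dots,S_T)$ with $S_1\subseteq\dots\subseteq S_T\subseteq[n]$ is feasible if $\sum_{i\in S_t}w_i\le W_t$ for all $t$; an optimal chain is a feasible chain maximizing $\sum_{t\in[T]}\Delta_t\gamma(S_t)$. A set $S\subseteq[n]$ is independent if $\gamma(S)=\sum_{i\in S}p_i$; a chain is independent if each of $S_1,\dots,S_T$ is independent.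
   Formalization: The item weights $w_i$ are nonnegative rationals. -}

module Defs where

open import Data.Nat using (ℕ; zero; suc; _+_; _*_; _≤_)
open import Data.Fin using (Fin; toℕ)
open import Data.Fin.Subset using (Subset; _∈_; _⊆_; _∪_; _∩_; ⁅_⁆; inside; outside)
open import Data.Vec using (Vec; []; _∷_; lookup; tabulate)
import Data.Vec as V
open import Data.Rational as Q using (ℚ; 0ℚ)
open import Data.Integer using (+_)
open import Data.Product using (_×_; Σ)
open import Data.Sum using (_⊎_)
open import Relation.Binary.PropositionalEquality using (_≡_)

weightSum : {n : ℕ} → Subset n → (Fin n → ℚ) → ℚ
weightSum []            f = 0ℚ
weightSum (inside  ∷ S) f = f Data.Fin.zero Q.+ weightSum S (λ i → f (Data.Fin.suc i))
weightSum (outside ∷ S) f = weightSum S (λ i → f (Data.Fin.suc i))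

sumFin : {T : ℕ} → (Fin T → ℕ) → ℕ
sumFin f = V.sum (tabulate f)

toℚ : ℕ → ℚ
toℚ k = + k Q./ 1

record Instance (n T : ℕ) : Set where
  field
    w        : Fin n → ℚ
    w-nonneg : ∀ i → 0ℚ Q.≤ w i
    p        : Fin n → ℕ
    p-pos    : ∀ i → 1 ≤ p i
    Δ        : Fin T → ℕ
    W        : Fin T → ℕ
    W-pos    : ∀ t → 1 ≤ W t
    W-mono   : ∀ t t' → toℕ t ≤ toℕ t' → W t ≤ W t'
    γ        : Subset n → ℕ
    γ-empty  : γ (Data.Fin.Subset.⊥) ≡ 0
    γ-mono   : ∀ A B → A ⊆ B → γ A ≤ γ B
    γ-submod : ∀ A B → γ (A ∪ B) + γ (A ∩ B) ≤ γ A + γ B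
    γ-marg   : ∀ (S : Subset n) (i : Fin n) →
                 (γ (S ∪ ⁅ i ⁆) ≡ γ S) ⊎ (γ (S ∪ ⁅ i ⁆) ≡ γ S + p i)

module _ {n T : ℕ} (I : Instance n T) where
  open Instance I

  Chain : Set
  Chain = Fin T → Subset n

  IsChain : Chain → Set
  IsChain S = ∀ t t' → toℕ t ≤ toℕ t' → S t ⊆ S t'

  Feasible : Chain → Set
  Feasible S = IsChain S × (∀ t → weightSum (S t) w Q.≤ toℚ (W t))

  value : Chain → ℕ
  value S = sumFin (λ t → Δ t * γ (S t))

  Optimal : Chain → Set
  Optimal S = Feasible S × (∀ S' → Feasible S' → value S' ≤ value S)

  pSum : Subset n → ℕ
  pSum S = V.sum (tabulate (λ i → indicator i))
    where
      indicator : Fin n → ℕ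
      indicator i with lookup S i
      ... | inside  = p i
      ... | outside = 0

  Independent : Subset n → Set
  Independent S = γ S ≡ pSum S

  IndependentChain : Chain → Set
  IndependentChain S = ∀ t → Independent (S t)

-- An optimal chain exists because there are finitely many chains. It is then made independent
-- without changing any γ (S t): going up the chain, the independent set chosen at t − 1 is
-- extended greedily inside S t, keeping an element when it raises γ by its profit and deleting
-- it from S t when it raises γ by 0. By submodularity such an element adds nothing to any
-- superset either, so the deletion preserves γ (S t). The resulting chain lies below the
-- optimal one, hence is feasible, and has the same value.
module Submission where

open import Defs
open import Data.Bool.Base using (if_then_else_)
open import Data.Empty using (⊥-elim)
open import Data.Fin using (Fin; zero; suc; toℕ; _≟_)
open import Data.Fin.Properties using (all?)
open import Data.Fin.Subset using (Subset; inside; outside; _∈_; _∉_; _⊆_; _∪_; _∩_; _-_; ⁅_⁆)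
import Data.Fin.Subset as Subset
open import Data.Fin.Subset.Properties
  using ( _∈?_; _⊆?_; ⊆-antisym; ⊆-trans; ⊆-min; ∪-identityʳ; x∈⁅x⁆; x∈⁅y⁆⇒x≡y; x∈p∪q⁺; x∈p∪q⁻
        ; x∈p∩q⁺; x∈p∩q⁻; p─q⊆p; p⊆p∪q; x∈p∧x≢y⇒x∈p-y; drop-∷-⊆)
open import Data.List using (List; []; _∷_; map; filter; cartesianProductWith; allFin)
open import Data.List.Extrema.Nat using (argmax; argmax-all; f[xs]≤f[argmax])
open import Data.List.Membership.Propositional using () renaming (_∈_ to _∈ₗ_)
open import Data.List.Membership.Propositional.Properties using (∈-cartesianProductWith⁺; ∈-map⁺; ∈-filter⁺; ∈-allFin)
open import Data.List.Relation.Unary.All using (lookup)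
open import Data.List.Relation.Unary.All.Properties using (all-filter)
open import Data.List.Relation.Unary.Any using (here; there)
open import Data.Nat using (ℕ; zero; suc; _+_; _*_; _≤_; z≤n; s≤s; _≤?_)
open import Data.Nat.Properties using (≤-antisym; +-comm; +-assoc; +-cancelˡ-≤)
open import Data.Product using (Σ; _×_; _,_; proj₁; proj₂)
open import Data.Rational as ℚ using (0ℚ)
import Data.Rational.Properties as ℚ
open import Data.Sum using (inj₁; inj₂)
open import Data.Vec using (Vec; []; _∷_; tabulate)
import Data.Vec as Vec
open import Data.Vec.Properties using (tabulate-cong; lookup∘tabulate)
open import Function using (_∘_)
open import Relation.Nullary using (yes; no; ¬?)
open import Relation.Nullary.Decidable using (_×-dec_; _→-dec_)
open import Relation.Unary using (Decidable)
open import Relation.Binary.PropositionalEquality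
  using (_≡_; _≗_; refl; sym; trans; cong; cong₂; subst; subst₂; module ≡-Reasoning)

allVecs : {A : Set} → List A → (k : ℕ) → List (Vec A k)
allVecs xs zero    = [] ∷ []
allVecs xs (suc k) = cartesianProductWith _∷_ xs (allVecs xs k)

∈-allVecs : {A : Set} {xs : List A} → (∀ x → x ∈ₗ xs) → ∀ {k} (v : Vec A k) → v ∈ₗ allVecs xs k
∈-allVecs all []      = here refl
∈-allVecs all (x ∷ v) = ∈-cartesianProductWith⁺ _∷_ (all x) (∈-allVecs all v)

allSubsets : (n : ℕ) → List (Subset n)
allSubsets = allVecs (inside ∷ outside ∷ [])

∈-allSubsets : ∀ {n} (S : Subset n) → S ∈ₗ allSubsets n
∈-allSubsets = ∈-allVecs λ { inside → here refl ; outside → there (here refl) }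

maximise : {A : Set} {P : A → Set} → Decidable P → (f : A → ℕ) → (xs : List A) → (a : A) → P a →
           Σ A λ b → P b × (∀ {x} → x ∈ₗ xs → P x → f x ≤ f b)
maximise P? f xs a Pa =
  argmax f a ys , argmax-all f Pa (all-filter P? xs) ,
  λ x∈xs Px → lookup (f[xs]≤f[argmax] a ys) (∈-filter⁺ P? x∈xs Px)
  where ys = filter P? xs

sumOver : ∀ {m} → Subset m → (Fin m → ℕ) → ℕ
sumOver S f = Vec.sum (tabulate λ i → if Vec.lookup S i then f i else 0)

sumOver-⊥ : ∀ {m} (f : Fin m → ℕ) → sumOver Subset.⊥ f ≡ 0
sumOver-⊥ {zero}  f = refl
sumOver-⊥ {suc m} f = sumOver-⊥ (f ∘ suc)

sumOver-∪⁅⁆ : ∀ {m} {i : Fin m} (S : Subset m) (f : Fin m → ℕ) → i ∉ S →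
              sumOver (S ∪ ⁅ i ⁆) f ≡ sumOver S f + f i
sumOver-∪⁅⁆ {i = zero}  (inside  ∷ S) f i∉S = ⊥-elim (i∉S Vec.here)
sumOver-∪⁅⁆ {i = zero}  (outside ∷ S) f i∉S rewrite ∪-identityʳ S = +-comm (f zero) _
sumOver-∪⁅⁆ {i = suc i} (inside  ∷ S) f i∉S =
  trans (cong (f zero +_) (sumOver-∪⁅⁆ S (f ∘ suc) (i∉S ∘ Vec.there))) (sym (+-assoc (f zero) _ _))
sumOver-∪⁅⁆ {i = suc i} (outside ∷ S) f i∉S = sumOver-∪⁅⁆ S (f ∘ suc) (i∉S ∘ Vec.there)

weightSum-⊥ : ∀ {m} (f : Fin m → ℚ.ℚ) → weightSum Subset.⊥ f ≡ 0ℚ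
weightSum-⊥ {zero}  f = refl
weightSum-⊥ {suc m} f = weightSum-⊥ (f ∘ suc)

weightSum-mono : ∀ {m} {A B : Subset m} (f : Fin m → ℚ.ℚ) → (∀ i → 0ℚ ℚ.≤ f i) → A ⊆ B →
                 weightSum A f ℚ.≤ weightSum B f
weightSum-mono {A = []}          {[]}          f f≥0 A⊆B = ℚ.≤-refl
weightSum-mono {A = inside  ∷ A} {inside  ∷ B} f f≥0 A⊆B =
  ℚ.+-monoʳ-≤ (f zero) (weightSum-mono (f ∘ suc) (f≥0 ∘ suc) (drop-∷-⊆ A⊆B))
weightSum-mono {A = inside  ∷ A} {outside ∷ B} f f≥0 A⊆B with A⊆B Vec.here
... | ()
weightSum-mono {A = outside ∷ A} {outside ∷ B} f f≥0 A⊆B =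
  weightSum-mono (f ∘ suc) (f≥0 ∘ suc) (drop-∷-⊆ A⊆B)
weightSum-mono {A = outside ∷ A} {inside  ∷ B} f f≥0 A⊆B =
  subst (ℚ._≤ _) (ℚ.+-identityˡ _)
        (ℚ.+-mono-≤ (f≥0 zero) (weightSum-mono (f ∘ suc) (f≥0 ∘ suc) (drop-∷-⊆ A⊆B)))

0≤toℚ : ∀ k → 0ℚ ℚ.≤ toℚ k
0≤toℚ k = ℚ.nonNegative⁻¹ (toℚ k) {{ℚ.normalize-nonNeg k 1}}

Ascending : ∀ {n k} → (Fin k → Subset n) → Set
Ascending S = ∀ t t′ → toℕ t ≤ toℕ t′ → S t ⊆ S t′

x∉p-x : ∀ {n} {x : Fin n} {p : Subset n} → x ∉ p - x
x∉p-x {x = zero}  {inside ∷ p} ()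
x∉p-x {x = zero}  {outside ∷ p} ()
x∉p-x {x = suc x} {s ∷ p} (Vec.there x∈p-x) = x∉p-x x∈p-x

module _ {n : ℕ} {p q : Subset n} {x : Fin n} where

  p⊆q∧x∉p⇒p⊆q-x : p ⊆ q → x ∉ p → p ⊆ q - x
  p⊆q∧x∉p⇒p⊆q-x p⊆q x∉p y∈p = x∈p∧x≢y⇒x∈p-y (p⊆q y∈p) λ { refl → x∉p y∈p }

  p⊆q∧x∈q⇒p∪⁅x⁆⊆q : p ⊆ q → x ∈ q → p ∪ ⁅ x ⁆ ⊆ q
  p⊆q∧x∈q⇒p∪⁅x⁆⊆q p⊆q x∈q y∈ with x∈p∪q⁻ p ⁅ x ⁆ y∈
  ... | inj₁ y∈p = p⊆q y∈p
  ... | inj₂ y∈x rewrite x∈⁅y⁆⇒x≡y x y∈x = x∈q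

  p⊆q⇒p∪⁅x⁆∪q≡q∪⁅x⁆ : p ⊆ q → (p ∪ ⁅ x ⁆) ∪ q ≡ q ∪ ⁅ x ⁆
  p⊆q⇒p∪⁅x⁆∪q≡q∪⁅x⁆ p⊆q = ⊆-antisym ⊆q∪x q∪x⊆
    where
    ⊆q∪x : (p ∪ ⁅ x ⁆) ∪ q ⊆ q ∪ ⁅ x ⁆
    ⊆q∪x y∈ with x∈p∪q⁻ (p ∪ ⁅ x ⁆) q y∈
    ... | inj₂ y∈q = x∈p∪q⁺ (inj₁ y∈q)
    ... | inj₁ y∈p∪x with x∈p∪q⁻ p ⁅ x ⁆ y∈p∪x
    ...   | inj₁ y∈p = x∈p∪q⁺ (inj₁ (p⊆q y∈p))
    ...   | inj₂ y∈x = x∈p∪q⁺ (inj₂ y∈x)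
    q∪x⊆ : q ∪ ⁅ x ⁆ ⊆ (p ∪ ⁅ x ⁆) ∪ q
    q∪x⊆ y∈ with x∈p∪q⁻ q ⁅ x ⁆ y∈
    ... | inj₁ y∈q = x∈p∪q⁺ (inj₂ y∈q)
    ... | inj₂ y∈x = x∈p∪q⁺ (inj₁ (x∈p∪q⁺ (inj₂ y∈x)))

  p⊆q∧x∉q⇒[p∪⁅x⁆]∩q≡p : p ⊆ q → x ∉ q → (p ∪ ⁅ x ⁆) ∩ q ≡ p
  p⊆q∧x∉q⇒[p∪⁅x⁆]∩q≡p p⊆q x∉q = ⊆-antisym ⊆p (λ y∈p → x∈p∩q⁺ (x∈p∪q⁺ (inj₁ y∈p) , p⊆q y∈p))
    where
    ⊆p : (p ∪ ⁅ x ⁆) ∩ q ⊆ p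
    ⊆p y∈ with x∈p∩q⁻ (p ∪ ⁅ x ⁆) q y∈
    ... | y∈p∪x , y∈q with x∈p∪q⁻ p ⁅ x ⁆ y∈p∪x
    ...   | inj₁ y∈p = y∈p
    ...   | inj₂ y∈x rewrite x∈⁅y⁆⇒x≡y x y∈x = ⊥-elim (x∉q y∈q)

x∈p⇒p-x∪⁅x⁆≡p : ∀ {n} {p : Subset n} {x} → x ∈ p → (p - x) ∪ ⁅ x ⁆ ≡ p
x∈p⇒p-x∪⁅x⁆≡p {p = p} {x} x∈p = ⊆-antisym (p⊆q∧x∈q⇒p∪⁅x⁆⊆q (p─q⊆p p ⁅ x ⁆) x∈p) p⊆
  where
  p⊆ : p ⊆ (p - x) ∪ ⁅ x ⁆
  p⊆ {y} y∈p with y ≟ x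
  ... | yes refl = x∈p∪q⁺ (inj₂ (x∈⁅x⁆ x))
  ... | no y≢x   = x∈p∪q⁺ (inj₁ (x∈p∧x≢y⇒x∈p-y y∈p y≢x))

module _ {n T : ℕ} (I : Instance n T) where
  open Instance I

  -- The left-hand side of indicator is the unnamed local function of pSum; unification
  -- with its use in pSum≡sumOver fixes it.
  mutual
    pSum≡sumOver : ∀ S → pSum I S ≡ sumOver S p
    pSum≡sumOver S = cong Vec.sum (tabulate-cong (indicator S))

    indicator : ∀ S i → _ ≡ (if Vec.lookup S i then p i else 0)
    indicator S i with Vec.lookup S i
    ... | inside  = refl
    ... | outside = refl

  ⊥-independent : Independent I Subset.⊥
  ⊥-independent = trans γ-empty (sym (trans (pSum≡sumOver Subset.⊥) (sumOver-⊥ p)))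

  ∪⁅⁆-independent : ∀ {A i} → Independent I A → i ∉ A → γ (A ∪ ⁅ i ⁆) ≡ γ A + p i →
                    Independent I (A ∪ ⁅ i ⁆)
  ∪⁅⁆-independent {A} {i} indA i∉A gain = begin
    γ (A ∪ ⁅ i ⁆)          ≡⟨ gain ⟩
    γ A + p i              ≡⟨ cong (_+ p i) (trans indA (pSum≡sumOver A)) ⟩
    sumOver A p + p i      ≡⟨ sumOver-∪⁅⁆ A p i∉A ⟨
    sumOver (A ∪ ⁅ i ⁆) p  ≡⟨ pSum≡sumOver (A ∪ ⁅ i ⁆) ⟨
    pSum I (A ∪ ⁅ i ⁆)     ∎
    where open ≡-Reasoning

  γ-flat-mono : ∀ {A B i} → A ⊆ B → i ∉ B → γ (A ∪ ⁅ i ⁆) ≡ γ A → γ (B ∪ ⁅ i ⁆) ≡ γ B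
  γ-flat-mono {A} {B} {i} A⊆B i∉B flat = ≤-antisym γB∪i≤γB (γ-mono B (B ∪ ⁅ i ⁆) (p⊆p∪q ⁅ i ⁆))
    where
    submod : γ (B ∪ ⁅ i ⁆) + γ A ≤ γ A + γ B
    submod = subst₂ _≤_
      (cong₂ _+_ (cong γ (p⊆q⇒p∪⁅x⁆∪q≡q∪⁅x⁆ A⊆B)) (cong γ (p⊆q∧x∉q⇒[p∪⁅x⁆]∩q≡p A⊆B i∉B)))
      (cong (_+ γ B) flat)
      (γ-submod (A ∪ ⁅ i ⁆) B)
    γB∪i≤γB : γ (B ∪ ⁅ i ⁆) ≤ γ B
    γB∪i≤γB = +-cancelˡ-≤ (γ A) _ _ (subst (_≤ γ A + γ B) (+-comm (γ (B ∪ ⁅ i ⁆)) (γ A)) submod)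

  γ-flat-remove : ∀ {A B i} → A ⊆ B → i ∈ B → i ∉ A → γ (A ∪ ⁅ i ⁆) ≡ γ A → γ (B - i) ≡ γ B
  γ-flat-remove {A} {B} {i} A⊆B i∈B i∉A flat =
    trans (sym (γ-flat-mono (p⊆q∧x∉p⇒p⊆q-x A⊆B i∉A) x∉p-x flat)) (cong γ (x∈p⇒p-x∪⁅x⁆≡p i∈B))

  record IndependentSpan (A B : Subset n) : Set where
    field
      set         : Subset n
      lower       : A ⊆ set
      upper       : set ⊆ B
      independent : Independent I set
      spans       : γ set ≡ γ B

  open IndependentSpan

  shrinkLower : ∀ {A′ A B} → A′ ⊆ A → IndependentSpan A B → IndependentSpan A′ B
  shrinkLower A′⊆A C = record
    { set = set C ; lower = ⊆-trans A′⊆A (lower C) ; upper = upper C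
    ; independent = independent C ; spans = spans C }

  growUpper : ∀ {A B′ B} → B′ ⊆ B → γ B′ ≡ γ B → IndependentSpan A B′ → IndependentSpan A B
  growUpper B′⊆B γB′≡γB C = record
    { set = set C ; lower = lower C ; upper = ⊆-trans (upper C) B′⊆B
    ; independent = independent C ; spans = trans (spans C) γB′≡γB }

  extendAlong : ∀ {A B} (L : List (Fin n)) → Independent I A → A ⊆ B →
                (∀ {j} → j ∈ B → j ∉ A → j ∈ₗ L) → IndependentSpan A B
  extendAlong {A} {B} [] indA A⊆B cover = record
    { set = A ; lower = λ x∈A → x∈A ; upper = A⊆B ; independent = indA ; spans = cong γ (⊆-antisym A⊆B B⊆A) }
    where
    B⊆A : B ⊆ A
    B⊆A {j} j∈B with j ∈? A
    ... | yes j∈A = j∈A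
    ... | no j∉A with cover j∈B j∉A
    ...   | ()
  extendAlong {A} {B} (i ∷ L) indA A⊆B cover with (i ∈? B) ×-dec ¬? (i ∈? A)
  ... | no ¬new = extendAlong L indA A⊆B cover′
    where
    cover′ : ∀ {j} → j ∈ B → j ∉ A → j ∈ₗ L
    cover′ j∈B j∉A with cover j∈B j∉A
    ... | here refl = ⊥-elim (¬new (j∈B , j∉A))
    ... | there j∈L = j∈L
  ... | yes (i∈B , i∉A) with γ-marg A i
  ...   | inj₂ gain = shrinkLower (p⊆p∪q ⁅ i ⁆) span
    where
    cover′ : ∀ {j} → j ∈ B → j ∉ A ∪ ⁅ i ⁆ → j ∈ₗ L
    cover′ j∈B j∉A∪i with cover j∈B (λ j∈A → j∉A∪i (x∈p∪q⁺ (inj₁ j∈A)))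
    ... | here refl = ⊥-elim (j∉A∪i (x∈p∪q⁺ (inj₂ (x∈⁅x⁆ i))))
    ... | there j∈L = j∈L
    span : IndependentSpan (A ∪ ⁅ i ⁆) B
    span = extendAlong L (∪⁅⁆-independent indA i∉A gain) (p⊆q∧x∈q⇒p∪⁅x⁆⊆q A⊆B i∈B) cover′
  ...   | inj₁ flat = growUpper (p─q⊆p B ⁅ i ⁆) (γ-flat-remove A⊆B i∈B i∉A flat) span
    where
    cover′ : ∀ {j} → j ∈ B - i → j ∉ A → j ∈ₗ L
    cover′ j∈B-i j∉A with cover (p─q⊆p B ⁅ i ⁆ j∈B-i) j∉A
    ... | here refl = ⊥-elim (x∉p-x j∈B-i)
    ... | there j∈L = j∈L
    span : IndependentSpan A (B - i)
    span = extendAlong L indA (p⊆q∧x∉p⇒p⊆q-x A⊆B i∉A) cover′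

  extend : ∀ {A B} → Independent I A → A ⊆ B → IndependentSpan A B
  extend indA A⊆B = extendAlong (allFin n) indA A⊆B λ {j} _ _ → ∈-allFin j

  independentRefinement : ∀ {k C} (S : Fin k → Subset n) → Ascending S → Independent I C →
                          (∀ t → C ⊆ S t) → Σ (∀ t → IndependentSpan C (S t)) λ R → Ascending (set ∘ R)
  independentRefinement {zero}      S S↑ indC C⊆S = (λ ()) , λ ()
  independentRefinement {suc k} {C} S S↑ indC C⊆S = R , R↑
    where
    first : IndependentSpan C (S zero)
    first = extend indC (C⊆S zero)
    rest : Σ (∀ t → IndependentSpan (set first) (S (suc t))) λ R → Ascending (set ∘ R)
    rest = independentRefinement (S ∘ suc) (λ t t′ t≤t′ → S↑ (suc t) (suc t′) (s≤s t≤t′))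
             (independent first) (λ t → ⊆-trans (upper first) (S↑ zero (suc t) z≤n))
    R : ∀ t → IndependentSpan C (S t)
    R zero    = first
    R (suc t) = shrinkLower (lower first) (proj₁ rest t)
    R↑ : Ascending (set ∘ R)
    R↑ zero    zero     _         = λ x∈ → x∈
    R↑ zero    (suc t′) _         = lower (proj₁ rest t′)
    R↑ (suc t) (suc t′) (s≤s t≤t′) = proj₂ rest t t′ t≤t′

  value-cong : ∀ {S S′ : Chain I} → (∀ t → γ (S t) ≡ γ (S′ t)) → value I S ≡ value I S′
  value-cong γS≡γS′ = cong Vec.sum (tabulate-cong λ t → cong (Δ t *_) (γS≡γS′ t))

  Feasible-resp : ∀ {S S′ : Chain I} → S ≗ S′ → Feasible I S → Feasible I S′
  Feasible-resp {S} {S′} S≗S′ (S↑ , fits) =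
    (λ t t′ t≤t′ → subst₂ _⊆_ (S≗S′ t) (S≗S′ t′) (S↑ t t′ t≤t′)) ,
    (λ t → subst (λ X → weightSum X w ℚ.≤ toℚ (W t)) (S≗S′ t) (fits t))

  feasible? : Decidable (Feasible I)
  feasible? S = all? (λ t → all? λ t′ → (toℕ t ≤? toℕ t′) →-dec (S t ⊆? S t′))
         ×-dec all? (λ t → weightSum (S t) w ℚ.≤? toℚ (W t))

  ⊥-feasible : Feasible I (λ _ → Subset.⊥)
  ⊥-feasible = (λ _ _ _ x∈ → x∈) , λ t → subst (ℚ._≤ toℚ (W t)) (sym (weightSum-⊥ w)) (0≤toℚ (W t))

  optimalChain : Σ (Chain I) (Optimal I)
  optimalChain
    with maximise feasible? (value I) (map Vec.lookup (allVecs (allSubsets n) T)) (λ _ → Subset.⊥) ⊥-feasible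
  ... | S , feasS , best = S , feasS , λ S′ feasS′ →
    subst (_≤ value I S) (value-cong (cong γ ∘ lookup∘tabulate S′))
      (best (∈-map⁺ Vec.lookup (∈-allVecs ∈-allSubsets (tabulate S′)))
            (Feasible-resp (sym ∘ lookup∘tabulate S′) feasS′))

lemma2 : ∀ {n T : ℕ} (I : Instance n T) →
    Σ (Chain I) (λ S → Optimal I S × IndependentChain I S)
lemma2 I with optimalChain I
... | S , (S↑ , fits) , best with independentRefinement I S S↑ (⊥-independent I) (λ t → ⊆-min (S t))
...   | R , R↑ = set ∘ R , ((R↑ , fitsR) , optimalR) , independent ∘ R
  where
  open Instance I
  open IndependentSpan
  fitsR : ∀ t → weightSum (set (R t)) w ℚ.≤ toℚ (W t)
  fitsR t = ℚ.≤-trans (weightSum-mono w w-nonneg (upper (R t))) (fits t)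
  optimalR : ∀ S′ → Feasible I S′ → value I S′ ≤ value I (set ∘ R)
  optimalR S′ feasS′ = subst (value I S′ ≤_) (value-cong I (sym ∘ spans ∘ R)) (best S′ feasS′)
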